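{- Let $q$ be an odd prime power and $\mathcal{P}$ a set of $8q^2$ points in $\mathbb{F}_q^3$. Then the number of distinct radii of spheres determined by $\mathcal{P}$ is at least $q/9$.
   Context: A sphere in $\mathbb{F}_q^3$ with center $(e_1,e_2,e_3)\in\mathbb{F}_q^3$ and radius $r\in\mathbb{F}_q$ is the set $\{(x,y,z)\in\mathbb{F}_q^3:(x-e_1)^2+(y-e_2)^2+(z-e_3)^2=r\}$. A sphere is determined by $\mathcal{P}$ if it passes through four non-coplanar points of $\mathcal{P}$. -}

module Defs where

open import Data.Nat using (ℕ; _^_; _%_) renaming (suc to sucℕ)
open import Data.Nat.Primality using (Prime)
open import Data.Fin using (Fin)
open import Data.Product using (Σ; ∃; _×_; _,_)
open import Data.List using (List)
open import Data.List.Membership.Propositional using (_∈_)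
open import Relation.Nullary using (¬_)
open import Relation.Binary.PropositionalEquality using (_≡_)
open import Relation.Binary.Definitions using (DecidableEquality)
open import Algebra.Core using (Op₁; Op₂)
open import Algebra.Structures using (IsCommutativeRing)
open import Function.Bundles using (_↔_)

IsPrimePower : ℕ → Set
IsPrimePower q = Σ ℕ λ p → Σ ℕ λ k → Prime p × q ≡ p ^ sucℕ k

Odd : ℕ → Set
Odd q = q % 2 ≡ 1

record FiniteField (q : ℕ) : Set₁ where
  infixl 7 _*_
  infixl 6 _+_
  field
    Carrier           : Set
    _+_ _*_           : Op₂ Carrier
    -_                : Op₁ Carrier
    0# 1#             : Carrier
    isCommutativeRing : IsCommutativeRing _≡_ _+_ _*_ -_ 0# 1#
    0≢1               : ¬ (0# ≡ 1#)
    inverse           : ∀ x → ¬ (x ≡ 0#) → Σ Carrier λ y → x * y ≡ 1#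
    _≟_               : DecidableEquality Carrier
    enumeration       : Fin q ↔ Carrier

  _-_ : Op₂ Carrier
  x - y = x + (- y)

  sq : Op₁ Carrier
  sq x = x * x

  Point : Set
  Point = Carrier × Carrier × Carrier

  OnSphere : Point → Carrier → Point → Set
  OnSphere (e₁ , e₂ , e₃) r (x , y , z) =
    sq (x - e₁) + sq (y - e₂) + sq (z - e₃) ≡ r

  OnPlane : Carrier → Carrier → Carrier → Carrier → Point → Set
  OnPlane a b c d (x , y , z) = a * x + b * y + c * z ≡ d

  Coplanar : Point → Point → Point → Point → Set
  Coplanar p₁ p₂ p₃ p₄ =
    Σ Carrier λ a → Σ Carrier λ b → Σ Carrier λ c → Σ Carrier λ d →
      ¬ (a ≡ 0# × b ≡ 0# × c ≡ 0#) ×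
      OnPlane a b c d p₁ × OnPlane a b c d p₂ ×
      OnPlane a b c d p₃ × OnPlane a b c d p₄

  DeterminedSphere : List Point → Point → Carrier → Set
  DeterminedSphere 𝒫 e r =
    Σ Point λ p₁ → Σ Point λ p₂ → Σ Point λ p₃ → Σ Point λ p₄ →
      (p₁ ∈ 𝒫 × p₂ ∈ 𝒫 × p₃ ∈ 𝒫 × p₄ ∈ 𝒫) ×
      ¬ Coplanar p₁ p₂ p₃ p₄ ×
      (OnSphere e r p₁ × OnSphere e r p₂ × OnSphere e r p₃ × OnSphere e r p₄)

  DeterminedRadius : List Point → Carrier → Set
  DeterminedRadius 𝒫 r = Σ Point λ e → DeterminedSphere 𝒫 e r

module Submission where

open import Defs
open import Data.Nat using (ℕ; _≤_) renaming (_*_ to _*ℕ_)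
open import Data.Product using (Σ; _×_)
open import Data.List using (List; length)
open import Data.List.Relation.Unary.All using (All)
open import Data.List.Relation.Unary.Unique.Propositional using (Unique)
open import Relation.Binary.PropositionalEquality using (_≡_)
open import Data.Product using (_,_)
open import Algebra.Bundles using (CommutativeRing)

-- For a centre e let n_e(r) be the number of points of 𝒫 on the sphere of radius r about e, and
-- E(e) = Σ_r n_e(r)², the number of pairs (p , p′) ∈ 𝒫² equidistant from e.  Since 2 ≠ 0 in F, the
-- centres equidistant from two distinct points form a plane, so Σ_e E(e) ≤ N q³ + N² q² (N = |𝒫|)
-- and some e has q³ E(e) ≤ N (q³ + N q²).  A plane meets a sphere in at most 2q points, hence a
-- sphere about e through more than 2q points of 𝒫 contains four non-coplanar ones and its radius is
-- determined.  These rich radii carry at least N − 2q² = 6q² of the N incidences, and Cauchy–Schwarz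
-- turns E(e) ≥ (6q²)² / #radii into q ≤ 2 · #radii.

-- Unlike Algebra.Solver.Ring.Simple, which takes its coefficients from R itself, this solver compares
-- coefficients in ℤ, where equality computes, so that `solve n eq refl` succeeds over any R.
module IntegerCoefficientSolver {a ℓ} (R : CommutativeRing a ℓ) where
  open import Data.Nat as ℕ using (zero; suc)
  import Data.Nat.Properties as ℕ
  open import Data.Integer as ℤ using (ℤ; +_; -[1+_]; _⊖_)
  import Data.Integer.Properties as ℤ
  open import Data.Sign as Sign using (Sign)
  open import Data.Maybe using (Maybe; just; nothing)
  open import Algebra.Solver.Ring.AlmostCommutativeRing
      using (fromCommutativeRing; _-Raw-AlmostCommutative⟶_)
  open import Relation.Nullary using (yes; no)
  import Relation.Binary.PropositionalEquality as ≡

  open CommutativeRing R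
  open import Algebra.Properties.Ring ring
    using (-‿distribˡ-*; -‿distribʳ-*; -0#≈0#; -‿involutive; -‿+-comm)
  open import Algebra.Properties.Semiring.Mult semiring
    using (×-homo-+; ×1-homo-*) renaming (_×_ to _·_)
  open import Relation.Binary.Reasoning.Setoid setoid

  signed : Sign → Carrier → Carrier
  signed Sign.+ x = x
  signed Sign.- x = - x

  ⟦_⟧ : ℤ → Carrier
  ⟦ + n ⟧      = n · 1#
  ⟦ -[1+ n ] ⟧ = - (suc n · 1#)

  ⟦◃⟧ : ∀ s n → ⟦ s ℤ.◃ n ⟧ ≈ signed s (n · 1#)
  ⟦◃⟧ Sign.+ zero    = refl
  ⟦◃⟧ Sign.- zero    = sym -0#≈0#
  ⟦◃⟧ Sign.+ (suc n) = refl
  ⟦◃⟧ Sign.- (suc n) = refl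

  ⟦⟧-signAbs : ∀ i → ⟦ i ⟧ ≈ signed (ℤ.sign i) (ℤ.∣ i ∣ · 1#)
  ⟦⟧-signAbs (+ zero)  = refl
  ⟦⟧-signAbs (+ suc n) = refl
  ⟦⟧-signAbs -[1+ n ]  = refl

  signed-* : ∀ s t x y → signed (s Sign.* t) (x * y) ≈ signed s x * signed t y
  signed-* Sign.+ Sign.+ x y = refl
  signed-* Sign.+ Sign.- x y = -‿distribʳ-* x y
  signed-* Sign.- Sign.+ x y = -‿distribˡ-* x y
  signed-* Sign.- Sign.- x y = begin
    x * y           ≈⟨ -‿involutive (x * y) ⟨
    - - (x * y)     ≈⟨ -‿cong (-‿distribʳ-* x y) ⟩
    - (x * - y)     ≈⟨ -‿distribˡ-* x (- y) ⟩
    - x * - y       ∎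

  *-homo : ∀ i j → ⟦ i ℤ.* j ⟧ ≈ ⟦ i ⟧ * ⟦ j ⟧
  *-homo i j = begin
    ⟦ s ℤ.◃ m ℕ.* n ⟧                     ≈⟨ ⟦◃⟧ s (m ℕ.* n) ⟩
    signed s ((m ℕ.* n) · 1#)             ≈⟨ signed-cong s (×1-homo-* m n) ⟩
    signed s ((m · 1#) * (n · 1#))        ≈⟨ signed-* (ℤ.sign i) (ℤ.sign j) _ _ ⟩
    signed (ℤ.sign i) (m · 1#) * signed (ℤ.sign j) (n · 1#)
                                          ≈⟨ *-cong (⟦⟧-signAbs i) (⟦⟧-signAbs j) ⟨
    ⟦ i ⟧ * ⟦ j ⟧                         ∎
    where
    s = ℤ.sign i Sign.* ℤ.sign j
    m = ℤ.∣ i ∣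
    n = ℤ.∣ j ∣
    signed-cong : ∀ s {x y} → x ≈ y → signed s x ≈ signed s y
    signed-cong Sign.+ x≈y = x≈y
    signed-cong Sign.- x≈y = -‿cong x≈y

  ⊖-homo : ∀ m n → ⟦ m ⊖ n ⟧ ≈ m · 1# - n · 1#
  ⊖-homo m       zero    = sym (trans (+-congˡ -0#≈0#) (+-identityʳ _))
  ⊖-homo zero    (suc n) = sym (+-identityˡ _)
  ⊖-homo (suc m) (suc n) = begin
    ⟦ suc m ⊖ suc n ⟧                 ≡⟨ ≡.cong ⟦_⟧ (ℤ.[1+m]⊖[1+n]≡m⊖n m n) ⟩
    ⟦ m ⊖ n ⟧                         ≈⟨ ⊖-homo m n ⟩
    M - N                             ≈⟨ +-identityˡ _ ⟨
    0# + (M - N)                      ≈⟨ +-congʳ (-‿inverseʳ 1#) ⟨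
    (1# - 1#) + (M - N)               ≈⟨ +-assoc 1# (- 1#) _ ⟩
    1# + (- 1# + (M - N))             ≈⟨ +-congˡ (+-assoc (- 1#) M _) ⟨
    1# + ((- 1# + M) - N)             ≈⟨ +-congˡ (+-congʳ (+-comm (- 1#) M)) ⟩
    1# + ((M - 1#) - N)               ≈⟨ +-congˡ (+-assoc M (- 1#) _) ⟩
    1# + (M + (- 1# - N))             ≈⟨ +-assoc 1# M _ ⟨
    (1# + M) + (- 1# - N)             ≈⟨ +-congˡ (-‿+-comm 1# N) ⟩
    (1# + M) - (1# + N)               ∎
    where
    M = m · 1#
    N = n · 1#

  +-homo : ∀ i j → ⟦ i ℤ.+ j ⟧ ≈ ⟦ i ⟧ + ⟦ j ⟧
  +-homo (+ m)    (+ n)    = ×-homo-+ 1# m n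
  +-homo (+ m)    -[1+ n ] = ⊖-homo m (suc n)
  +-homo -[1+ m ] (+ n)    = trans (⊖-homo n (suc m)) (+-comm _ _)
  +-homo -[1+ m ] -[1+ n ] = begin
    - (suc (suc (m ℕ.+ n)) · 1#)      ≡⟨ ≡.cong (λ k → - (suc k · 1#)) (ℕ.+-suc m n) ⟨
    - ((suc m ℕ.+ suc n) · 1#)        ≈⟨ -‿cong (×-homo-+ 1# (suc m) (suc n)) ⟩
    - (suc m · 1# + suc n · 1#)       ≈⟨ -‿+-comm _ _ ⟨
    - (suc m · 1#) - suc n · 1#       ∎

  -‿homo : ∀ i → ⟦ ℤ.- i ⟧ ≈ - ⟦ i ⟧
  -‿homo -[1+ n ]  = sym (-‿involutive _)
  -‿homo (+ zero)  = sym -0#≈0#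
  -‿homo (+ suc n) = refl

  ⟦⟧-morphism : CommutativeRing.rawRing ℤ.+-*-commutativeRing
                  -Raw-AlmostCommutative⟶ fromCommutativeRing R
  ⟦⟧-morphism = record
    { ⟦_⟧ = ⟦_⟧ ; +-homo = +-homo ; *-homo = *-homo ; -‿homo = -‿homo
    ; 0-homo = refl ; 1-homo = +-identityʳ 1# }

  ⟦⟧-weaklyDecidable : ∀ i j → Maybe (⟦ i ⟧ ≈ ⟦ j ⟧)
  ⟦⟧-weaklyDecidable i j with i ℤ.≟ j
  ... | yes ≡.refl = just refl
  ... | no _       = nothing

  open import Algebra.Solver.Ring _ _ ⟦⟧-morphism ⟦⟧-weaklyDecidable public
    using (solve; _:+_; _:*_; _:-_; :-_; _:=_; con)

module Counting where

  open import Data.Nat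
  open import Data.Nat.Properties
  open import Data.Nat.Solver using (module +-*-Solver)
  open import Data.List using (List; []; _∷_; length; filter; map; _++_; cartesianProduct)
  open import Data.List.Properties using (length-++; length-map)
  open import Data.List.Extrema.Nat using (argmin; f[argmin]≤f[⊤]; f[argmin]≤f[xs])
  open import Data.Nat.Divisibility using (_∣_; divides)
  open import Data.List.Membership.Propositional using (_∈_)
  open import Data.List.Relation.Unary.Any using (here; there)
  open import Data.List.Relation.Unary.All as All using (All; []; _∷_)
  open import Data.List.Relation.Unary.AllPairs using ([]; _∷_)
  open import Data.List.Relation.Unary.Unique.Propositional using (Unique)
  open import Data.Product using (Σ; _,_)
  open import Data.Sum using (inj₁; inj₂)
  open import Data.Empty using (⊥; ⊥-elim)
  open import Function using (_∘_)
  open import Relation.Binary.Definitions using (DecidableEquality)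
  open import Relation.Binary.PropositionalEquality
  open import Relation.Nullary using (Dec; yes; no; ¬_)
  open import Relation.Unary using (Decidable)
  open +-*-Solver using (solve; _:+_; _:*_; _:^_; _:=_; con)

  𝟙 : ∀ {p} {P : Set p} → Dec P → ℕ
  𝟙 (yes _) = 1
  𝟙 (no _)  = 0

  𝟙≤1 : ∀ {p} {P : Set p} (P? : Dec P) → 𝟙 P? ≤ 1
  𝟙≤1 (yes _) = ≤-refl
  𝟙≤1 (no _)  = z≤n

  module _ {a} {A : Set a} where

    ∑ : List A → (A → ℕ) → ℕ
    ∑ []       f = 0
    ∑ (x ∷ xs) f = f x + ∑ xs f

    syntax ∑ xs (λ x → e) = ∑[ x ∈ xs ] e

    ∑-cong : ∀ xs {f g} → (∀ x → x ∈ xs → f x ≡ g x) → ∑ xs f ≡ ∑ xs g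
    ∑-cong []       f≗g = refl
    ∑-cong (x ∷ xs) f≗g = cong₂ _+_ (f≗g x (here refl)) (∑-cong xs (λ y → f≗g y ∘ there))

    ∑-mono-≤ : ∀ xs {f g} → (∀ x → x ∈ xs → f x ≤ g x) → ∑ xs f ≤ ∑ xs g
    ∑-mono-≤ []       f≤g = z≤n
    ∑-mono-≤ (x ∷ xs) f≤g = +-mono-≤ (f≤g x (here refl)) (∑-mono-≤ xs (λ y → f≤g y ∘ there))

    ∑-const : ∀ xs c → ∑[ _ ∈ xs ] c ≡ length xs * c
    ∑-const []       c = refl
    ∑-const (x ∷ xs) c = cong (c +_) (∑-const xs c)

    length≡∑1 : ∀ xs → length xs ≡ ∑[ _ ∈ xs ] 1
    length≡∑1 xs = sym (trans (∑-const xs 1) (*-identityʳ _))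

    ∑-≤-length* : ∀ xs {f} c → (∀ x → x ∈ xs → f x ≤ c) → ∑ xs f ≤ length xs * c
    ∑-≤-length* xs c f≤c = subst (_ ≤_) (∑-const xs c) (∑-mono-≤ xs f≤c)

    ∑-distrib-+ : ∀ xs (f g : A → ℕ) → ∑[ x ∈ xs ] (f x + g x) ≡ ∑ xs f + ∑ xs g
    ∑-distrib-+ []       f g = refl
    ∑-distrib-+ (x ∷ xs) f g = begin
      f x + g x + ∑[ y ∈ xs ] (f y + g y) ≡⟨ cong (f x + g x +_) (∑-distrib-+ xs f g) ⟩
      f x + g x + (∑ xs f + ∑ xs g)       ≡⟨ +-interchange (f x) (g x) _ _ ⟩
      f x + ∑ xs f + (g x + ∑ xs g)       ∎
      where
      open ≡-Reasoning
      +-interchange : ∀ a b c d → a + b + (c + d) ≡ a + c + (b + d)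
      +-interchange = solve 4 (λ a b c d → a :+ b :+ (c :+ d) := a :+ c :+ (b :+ d)) refl

    ∑-*ˡ : ∀ xs c (f : A → ℕ) → ∑[ x ∈ xs ] (c * f x) ≡ c * ∑ xs f
    ∑-*ˡ []       c f = sym (*-zeroʳ c)
    ∑-*ˡ (x ∷ xs) c f = trans (cong (c * f x +_) (∑-*ˡ xs c f)) (sym (*-distribˡ-+ c (f x) _))

    ∑-*ʳ : ∀ xs c (f : A → ℕ) → ∑[ x ∈ xs ] (f x * c) ≡ ∑ xs f * c
    ∑-*ʳ xs c f = trans (∑-cong xs (λ x _ → *-comm (f x) c)) (trans (∑-*ˡ xs c f) (*-comm c _))

  module _ {a b} {A : Set a} {B : Set b} where

    ∑-comm : ∀ (xs : List A) (ys : List B) (f : A → B → ℕ) →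
             ∑[ x ∈ xs ] ∑[ y ∈ ys ] f x y ≡ ∑[ y ∈ ys ] ∑[ x ∈ xs ] f x y
    ∑-comm []       ys f = sym (trans (∑-const ys 0) (*-zeroʳ (length ys)))
    ∑-comm (x ∷ xs) ys f = trans (cong (∑ ys (f x) +_) (∑-comm xs ys f))
                                 (sym (∑-distrib-+ ys (f x) (λ y → ∑[ x′ ∈ xs ] f x′ y)))

    ∑*∑ : ∀ (xs : List A) (ys : List B) (f : A → ℕ) (g : B → ℕ) →
          ∑ xs f * ∑ ys g ≡ ∑[ x ∈ xs ] ∑[ y ∈ ys ] (f x * g y)
    ∑*∑ xs ys f g = trans (sym (∑-*ʳ xs (∑ ys g) f)) (∑-cong xs (λ x _ → sym (∑-*ˡ ys (f x) g)))

  module _ {a p} {A : Set a} {P : A → Set p} (P? : Decidable P) where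

    ∑-filter : ∀ xs (f : A → ℕ) → ∑ (filter P? xs) f ≡ ∑[ x ∈ xs ] (𝟙 (P? x) * f x)
    ∑-filter []       f = refl
    ∑-filter (x ∷ xs) f with P? x
    ... | yes _ = cong₂ _+_ (sym (+-identityʳ (f x))) (∑-filter xs f)
    ... | no  _ = ∑-filter xs f

    length-filter : ∀ xs → length (filter P? xs) ≡ ∑[ x ∈ xs ] 𝟙 (P? x)
    length-filter xs = begin
      length (filter P? xs)          ≡⟨ length≡∑1 (filter P? xs) ⟩
      ∑[ _ ∈ filter P? xs ] 1        ≡⟨ ∑-filter xs (λ _ → 1) ⟩
      ∑[ x ∈ xs ] (𝟙 (P? x) * 1)     ≡⟨ ∑-cong xs (λ x _ → *-identityʳ _) ⟩
      ∑[ x ∈ xs ] 𝟙 (P? x)           ∎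
      where open ≡-Reasoning

    ∑-filter-≤ : ∀ xs (f : A → ℕ) → ∑ (filter P? xs) f ≤ ∑ xs f
    ∑-filter-≤ xs f = subst (_≤ ∑ xs f) (sym (∑-filter xs f))
      (∑-mono-≤ xs (λ x _ → subst (𝟙 (P? x) * f x ≤_) (*-identityˡ (f x)) (*-monoˡ-≤ (f x) (𝟙≤1 (P? x)))))

    count≡0 : ∀ xs → All (¬_ ∘ P) xs → ∑[ x ∈ xs ] 𝟙 (P? x) ≡ 0
    count≡0 []       []         = refl
    count≡0 (x ∷ xs) (¬px ∷ ¬P) with P? x
    ... | yes px = ⊥-elim (¬px px)
    ... | no  _  = count≡0 xs ¬P

    count≤1 : ∀ xs → Unique xs → (∀ {x y} → x ∈ xs → y ∈ xs → P x → P y → x ≡ y) →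
              ∑[ x ∈ xs ] 𝟙 (P? x) ≤ 1
    count≤1 []       _          _ = z≤n
    count≤1 (x ∷ xs) (x∉ ∷ !xs) P-unique with P? x
    ... | yes px = ≤-reflexive (cong suc (count≡0 xs (All.tabulate λ y∈ py →
                     All.lookup x∉ y∈ (P-unique (here refl) (there y∈) px py))))
    ... | no  _  = count≤1 xs !xs (λ x∈ y∈ → P-unique (there x∈) (there y∈))

    count≤2 : DecidableEquality A → ∀ xs → Unique xs →
              (∀ {x y z} → x ∈ xs → y ∈ xs → z ∈ xs → P x → P y → P z →
               x ≢ y → x ≢ z → y ≢ z → ⊥) →
              ∑[ x ∈ xs ] 𝟙 (P? x) ≤ 2
    count≤2 _≟_ []       _          _ = z≤n
    count≤2 _≟_ (x ∷ xs) (x∉ ∷ !xs) no-three with P? x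
    ... | yes px = s≤s (count≤1 xs !xs P-unique)
      where
      P-unique : ∀ {y z} → y ∈ xs → z ∈ xs → P y → P z → y ≡ z
      P-unique {y} {z} y∈ z∈ py pz with y ≟ z
      ... | yes y≡z = y≡z
      ... | no  y≢z = ⊥-elim (no-three (here refl) (there y∈) (there z∈) px py pz
                        (All.lookup x∉ y∈) (All.lookup x∉ z∈) y≢z)
    ... | no  _  = count≤2 _≟_ xs !xs (λ x∈ y∈ z∈ → no-three (there x∈) (there y∈) (there z∈))

  module _ {a} {A : Set a} (_≟_ : DecidableEquality A) where

    ∑-select : ∀ xs {x} (g : A → ℕ) → Unique xs → x ∈ xs → ∑[ y ∈ xs ] (𝟙 (x ≟ y) * g y) ≡ g x
    ∑-select (y ∷ xs) {x} g (y∉ ∷ !xs) (here refl) with x ≟ y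
    ... | no  x≢x = ⊥-elim (x≢x refl)
    ... | yes _   = begin
      1 * g x + ∑[ z ∈ xs ] (𝟙 (x ≟ z) * g z)   ≡⟨ cong₂ _+_ (*-identityˡ (g x)) (∑-cong xs vanish) ⟩
      g x + ∑[ _ ∈ xs ] 0                       ≡⟨ cong (g x +_) (trans (∑-const xs 0) (*-zeroʳ (length xs))) ⟩
      g x + 0                                   ≡⟨ +-identityʳ (g x) ⟩
      g x                                       ∎
      where
      open ≡-Reasoning
      vanish : ∀ z → z ∈ xs → 𝟙 (x ≟ z) * g z ≡ 0
      vanish z z∈ with x ≟ z
      ... | yes refl = ⊥-elim (All.lookup y∉ z∈ refl)
      ... | no  _    = refl
    ∑-select (y ∷ xs) {x} g (y∉ ∷ !xs) (there x∈) with x ≟ y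
    ... | yes refl = ⊥-elim (All.lookup y∉ x∈ refl)
    ... | no  _    = ∑-select xs g !xs x∈

    count-≡ : ∀ xs {x} → Unique xs → x ∈ xs → ∑[ y ∈ xs ] 𝟙 (x ≟ y) ≡ 1
    count-≡ xs {x} !xs x∈ = trans (∑-cong xs (λ y _ → sym (*-identityʳ _))) (∑-select xs (λ _ → 1) !xs x∈)

    length≤fibres : ∀ {b} {B : Set b} (xs : List B) (key : B → A) {ys} k → Unique ys → (∀ x → key x ∈ ys) →
                    (∀ y → ∑[ x ∈ xs ] 𝟙 (key x ≟ y) ≤ k) → length xs ≤ length ys * k
    length≤fibres xs key {ys} k !ys key∈ fibre≤k = begin
      length xs                               ≡⟨ length≡∑1 xs ⟩
      ∑[ x ∈ xs ] 1                           ≡⟨ ∑-cong xs (λ x _ → count-≡ ys !ys (key∈ x)) ⟨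
      ∑[ x ∈ xs ] ∑[ y ∈ ys ] 𝟙 (key x ≟ y)   ≡⟨ ∑-comm xs ys _ ⟩
      ∑[ y ∈ ys ] ∑[ x ∈ xs ] 𝟙 (key x ≟ y)   ≤⟨ ∑-≤-length* ys k (λ y _ → fibre≤k y) ⟩
      length ys * k                           ∎
      where open ≤-Reasoning

    module _ {xs : List A} (!xs : Unique xs) (∈xs : ∀ x → x ∈ xs)
             (σ : A → A) (σ-involutive : ∀ x → σ (σ x) ≡ x) where

      ∑-reindex : ∀ g → ∑[ x ∈ xs ] g (σ x) ≡ ∑ xs g
      ∑-reindex g = begin
        ∑[ x ∈ xs ] g (σ x)                          ≡⟨ ∑-cong xs (λ x _ → ∑-select xs g !xs (∈xs (σ x))) ⟨
        ∑[ x ∈ xs ] ∑[ y ∈ xs ] (𝟙 (σ x ≟ y) * g y)  ≡⟨ ∑-comm xs xs _ ⟩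
        ∑[ y ∈ xs ] ∑[ x ∈ xs ] (𝟙 (σ x ≟ y) * g y)  ≡⟨ ∑-cong xs (λ y _ → ∑-*ʳ xs (g y) _) ⟩
        ∑[ y ∈ xs ] (∑[ x ∈ xs ] 𝟙 (σ x ≟ y) * g y)  ≡⟨ ∑-cong xs (λ y _ → cong (_* g y) (one-preimage y)) ⟩
        ∑[ y ∈ xs ] (1 * g y)                        ≡⟨ ∑-cong xs (λ y _ → *-identityˡ (g y)) ⟩
        ∑ xs g                                       ∎
        where
        open ≡-Reasoning
        transpose : ∀ x y → 𝟙 (σ x ≟ y) ≡ 𝟙 (σ y ≟ x)
        transpose x y with σ x ≟ y | σ y ≟ x
        ... | yes _    | yes _    = refl
        ... | no  _    | no  _    = refl
        ... | yes σx≡y | no  σy≢x = ⊥-elim (σy≢x (trans (cong σ (sym σx≡y)) (σ-involutive x)))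
        ... | no  σx≢y | yes σy≡x = ⊥-elim (σx≢y (trans (cong σ (sym σy≡x)) (σ-involutive y)))
        one-preimage : ∀ y → ∑[ x ∈ xs ] 𝟙 (σ x ≟ y) ≡ 1
        one-preimage y = trans (∑-cong xs (λ x _ → transpose x y)) (count-≡ xs !xs (∈xs (σ y)))

      even-length : (rank : A → ℕ) → (∀ {x y} → rank x ≡ rank y → x ≡ y) →
                    (∀ x → σ x ≢ x) → 2 ∣ length xs
      even-length rank rank-injective σ-fixpointFree = divides (∑ xs below) (begin
        length xs                             ≡⟨ length≡∑1 xs ⟩
        ∑[ _ ∈ xs ] 1                         ≡⟨ ∑-cong xs (λ x _ → below-pair x) ⟨
        ∑[ x ∈ xs ] (below x + below (σ x))   ≡⟨ ∑-distrib-+ xs below (below ∘ σ) ⟩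
        ∑ xs below + ∑[ x ∈ xs ] below (σ x)  ≡⟨ cong (∑ xs below +_) (∑-reindex below) ⟩
        ∑ xs below + ∑ xs below               ≡⟨ solve 1 (λ n → n :+ n := n :* con 2) refl (∑ xs below) ⟩
        ∑ xs below * 2                        ∎)
        where
        open ≡-Reasoning
        below : A → ℕ
        below x = 𝟙 (rank x <? rank (σ x))
        rank-σσ : ∀ {x} → rank (σ (σ x)) ≡ rank x
        rank-σσ {x} = cong rank (σ-involutive x)
        below-pair : ∀ x → below x + below (σ x) ≡ 1
        below-pair x with rank x <? rank (σ x) | rank (σ x) <? rank (σ (σ x))
        ... | yes x<σx | yes σx<σσx = ⊥-elim (<-asym x<σx (subst (rank (σ x) <_) rank-σσ σx<σσx))
        ... | yes _    | no  _      = refl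
        ... | no  _    | yes _      = refl
        ... | no  x≮σx | no  σx≮σσx = ⊥-elim (σ-fixpointFree x (rank-injective (≤-antisym
                (≮⇒≥ x≮σx) (≮⇒≥ (subst (rank (σ x) ≮_) rank-σσ σx≮σσx)))))

  module _ {a} {A : Set a} where

    below-average : ∀ (f : A → ℕ) xs → 0 < length xs → Σ A λ x → length xs * f x ≤ ∑ xs f
    below-average f (x ∷ xs) _ =
      argmin f x xs , subst (_≤ ∑ (x ∷ xs) f) (∑-const (x ∷ xs) _) (∑-mono-≤ (x ∷ xs) argmin≤)
      where
      argmin≤ : ∀ y → y ∈ x ∷ xs → f (argmin f x xs) ≤ f y
      argmin≤ y (here refl) = f[argmin]≤f[⊤] {f = f} x xs
      argmin≤ y (there y∈)  = All.lookup (f[argmin]≤f[xs] {f = f} x xs) y∈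

    private
      2a[a+c]≤a²+[a+c]² : ∀ a c → 2 * (a * (a + c)) ≤ a * a + (a + c) * (a + c)
      2a[a+c]≤a²+[a+c]² a c = subst (2 * (a * (a + c)) ≤_)
        (solve 2 (λ a c → con 2 :* (a :* (a :+ c)) :+ c :* c := a :* a :+ (a :+ c) :* (a :+ c)) refl a c)
        (m≤m+n _ (c * c))

      2ab≤a²+b² : ∀ a b → 2 * (a * b) ≤ a * a + b * b
      2ab≤a²+b² a b with ≤-total a b
      ... | inj₁ a≤b = subst (λ b → 2 * (a * b) ≤ a * a + b * b) (m+[n∸m]≡n a≤b) (2a[a+c]≤a²+[a+c]² a (b ∸ a))
      ... | inj₂ b≤a = subst (λ a → 2 * (a * b) ≤ a * a + b * b) (m+[n∸m]≡n b≤a)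
                         (subst₂ _≤_ (cong (2 *_) (*-comm b _)) (+-comm (b * b) _) (2a[a+c]≤a²+[a+c]² b (a ∸ b)))

    cauchy-schwarz : ∀ xs (f : A → ℕ) → ∑ xs f * ∑ xs f ≤ length xs * ∑[ x ∈ xs ] (f x * f x)
    cauchy-schwarz xs f = *-cancelˡ-≤ 2 (begin
      2 * (∑ xs f * ∑ xs f)
        ≡⟨ cong (2 *_) (∑*∑ xs xs f f) ⟩
      2 * ∑[ x ∈ xs ] ∑[ y ∈ xs ] (f x * f y)
        ≡⟨ trans (∑-cong xs (λ x _ → ∑-*ˡ xs 2 _)) (∑-*ˡ xs 2 _) ⟨
      ∑[ x ∈ xs ] ∑[ y ∈ xs ] (2 * (f x * f y))
        ≤⟨ ∑-mono-≤ xs (λ x _ → ∑-mono-≤ xs (λ y _ → 2ab≤a²+b² (f x) (f y))) ⟩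
      ∑[ x ∈ xs ] ∑[ y ∈ xs ] (f x * f x + f y * f y)
        ≡⟨ trans (∑-cong xs (λ x _ → ∑-distrib-+ xs _ _)) (∑-distrib-+ xs _ _) ⟩
      ∑[ x ∈ xs ] ∑[ _ ∈ xs ] (f x * f x) + ∑[ _ ∈ xs ] Q
        ≡⟨ cong₂ _+_ (trans (∑-cong xs (λ x _ → ∑-const xs _)) (∑-*ˡ xs (length xs) _)) (∑-const xs Q) ⟩
      length xs * Q + length xs * Q
        ≡⟨ solve 1 (λ n → n :+ n := con 2 :* n) refl (length xs * Q) ⟩
      2 * (length xs * Q)
        ∎)
      where
      Q = ∑[ x ∈ xs ] (f x * f x)
      open ≤-Reasoning

  length-cartesianProduct : ∀ {a b} {A : Set a} {B : Set b} (xs : List A) (ys : List B) →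
                            length (cartesianProduct xs ys) ≡ length xs * length ys
  length-cartesianProduct []       ys = refl
  length-cartesianProduct (x ∷ xs) ys = begin
    length (map (x ,_) ys ++ cartesianProduct xs ys)
      ≡⟨ length-++ (map (x ,_) ys) ⟩
    length (map (x ,_) ys) + length (cartesianProduct xs ys)
      ≡⟨ cong₂ _+_ (length-map (x ,_) ys) (length-cartesianProduct xs ys) ⟩
    length ys + length xs * length ys
      ∎
    where open ≡-Reasoning

  odd⇒positive : ∀ {q} → Odd q → 0 < q
  odd⇒positive {suc _} _ = z<s

  radii-arithmetic : ∀ {q k X E} → 0 < q → 8 * q * q ≤ X + q * (q * 2) → X * X ≤ k * E →
    q * (q * q) * E ≤ 8 * q * q * (q * (q * q) + 8 * q * q * (q * q)) → q ≤ 2 * k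
  radii-arithmetic {q} {k} {X} {E} 0<q N≤X+2q² X²≤kE q³E≤N[q³+Nq²] =
    *-cancelˡ-≤ 36 (*-cancelʳ-≤ (36 * q) (36 * (2 * k)) (q ^ 6) {{m^n≢0 q 6}} (begin
      36 * q * q ^ 6
        ≡⟨ solve 1 (λ q → con 36 :* q :* q :^ 6 := q :* (q :* q) :* (con 6 :* (q :* q) :* (con 6 :* (q :* q))))
                   refl q ⟩
      q * (q * q) * (6 * (q * q) * (6 * (q * q)))
        ≤⟨ *-monoʳ-≤ (q * (q * q)) (≤-trans (*-mono-≤ 6q²≤X 6q²≤X) X²≤kE) ⟩
      q * (q * q) * (k * E)
        ≡⟨ solve 3 (λ q k E → q :* (q :* q) :* (k :* E) := k :* (q :* (q :* q) :* E)) refl q k E ⟩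
      k * (q * (q * q) * E)
        ≤⟨ *-monoʳ-≤ k q³E≤N[q³+Nq²] ⟩
      k * (8 * q * q * (q * (q * q) + 8 * q * q * (q * q)))
        ≡⟨ solve 2 (λ q k → k :* (con 8 :* q :* q :* (q :* (q :* q) :+ con 8 :* q :* q :* (q :* q)))
                            := k :* (con 8 :* q :^ 5 :+ con 64 :* q :^ 6)) refl q k ⟩
      k * (8 * q ^ 5 + 64 * q ^ 6)
        ≤⟨ *-monoʳ-≤ k (+-monoˡ-≤ (64 * q ^ 6) (*-monoʳ-≤ 8 (m≤n*m (q ^ 5) q))) ⟩
      k * (8 * q ^ 6 + 64 * q ^ 6)
        ≡⟨ solve 2 (λ q k → k :* (con 8 :* q :^ 6 :+ con 64 :* q :^ 6) := con 36 :* (con 2 :* k) :* q :^ 6) refl q k ⟩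
      36 * (2 * k) * q ^ 6
        ∎))
    where
    open ≤-Reasoning
    instance
      q≢0 : NonZero q
      q≢0 = >-nonZero 0<q
    6q²≤X : 6 * (q * q) ≤ X
    6q²≤X = +-cancelʳ-≤ (q * (q * 2)) (6 * (q * q)) X (subst (_≤ X + q * (q * 2))
      (solve 1 (λ q → con 8 :* q :* q := con 6 :* (q :* q) :+ q :* (q :* con 2)) refl q) N≤X+2q²)

module FiniteFieldFacts {q : ℕ} (F : FiniteField q) where
  import Data.Nat.Properties as ℕ
  open import Data.Nat.Divisibility using (_∣_; n∣m⇒m%n≡0)
  import Data.Integer as ℤ
  open import Data.Fin using (toℕ)
  open import Data.Fin.Properties using (toℕ-injective)
  open import Data.List using (List; length; map; allFin)
  open import Data.List.Properties using (length-map; length-tabulate)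
  open import Data.List.Membership.Propositional using (_∈_)
  open import Data.List.Membership.Propositional.Properties using (∈-map⁺; ∈-allFin)
  open import Data.List.Relation.Unary.Unique.Propositional using (Unique)
  import Data.List.Relation.Unary.Unique.Propositional.Properties as Unique
  open import Data.Product using (_,_)
  open import Data.Sum using (_⊎_; inj₁; inj₂)
  open import Function using (_∘_)
  open import Data.Empty using (⊥-elim)
  open import Function.Bundles using (Inverse)
  open import Relation.Binary.PropositionalEquality
  open import Relation.Nullary using (yes; no)
  open Counting

  open FiniteField F public

  commutativeRing : CommutativeRing _ _
  commutativeRing = record { isCommutativeRing = isCommutativeRing }

  open CommutativeRing commutativeRing public
    using (+-identityˡ; +-identityʳ; *-identityˡ; zeroʳ)
  open IntegerCoefficientSolver commutativeRing public
    using (⟦_⟧; solve; _:+_; _:*_; _:-_; :-_; _:=_; con)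

  -- FiniteField's _-_ has no fixity declaration.
  infixl 6 _−_
  _−_ : Carrier → Carrier → Carrier
  x − y = x - y

  -- Defined so that the solver constant con (ℤ.+ 2) denotes it.
  2# : Carrier
  2# = ⟦ ℤ.+ 2 ⟧

  private
    module Enum = Inverse enumeration

  elements : List Carrier
  elements = map Enum.to (allFin q)

  ∈-elements : ∀ x → x ∈ elements
  ∈-elements x = subst (_∈ elements) (Enum.strictlyInverseˡ x) (∈-map⁺ Enum.to (∈-allFin (Enum.from x)))

  elements-unique : Unique elements
  elements-unique = Unique.map⁺ to-injective (Unique.allFin⁺ q)
    where
    to-injective : ∀ {i j} → Enum.to i ≡ Enum.to j → i ≡ j
    to-injective {i} {j} eq = trans (sym (Enum.strictlyInverseʳ i))
                                    (trans (cong Enum.from eq) (Enum.strictlyInverseʳ j))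

  length-elements : length elements ≡ q
  length-elements = trans (length-map Enum.to (allFin q)) (length-tabulate (λ i → i))

  −≡0⇒≡ : ∀ {x y} → x − y ≡ 0# → x ≡ y
  −≡0⇒≡ {x} {y} x−y≡0 = begin
    x             ≡⟨ solve 2 (λ x y → x := (x :- y) :+ y) refl x y ⟩
    (x − y) + y   ≡⟨ cong (_+ y) x−y≡0 ⟩
    0# + y        ≡⟨ +-identityˡ y ⟩
    y             ∎
    where open ≡-Reasoning

  ≡⇒−≡0 : ∀ {x y} → x ≡ y → x − y ≡ 0#
  ≡⇒−≡0 {x} refl = solve 1 (λ x → x :- x := con (ℤ.+ 0)) refl x

  ≡0⇒−≡0 : ∀ {x y} → x ≡ 0# → y ≡ 0# → x − y ≡ 0#
  ≡0⇒−≡0 x≡0 y≡0 = ≡⇒−≡0 (trans x≡0 (sym y≡0))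

  *≡0⇒≡0⊎≡0 : ∀ {x y} → x * y ≡ 0# → x ≡ 0# ⊎ y ≡ 0#
  *≡0⇒≡0⊎≡0 {x} {y} xy≡0 with x ≟ 0#
  ... | yes x≡0 = inj₁ x≡0
  ... | no  x≢0 with inverse x x≢0
  ... | x⁻¹ , xx⁻¹≡1 = inj₂ (begin
    y               ≡⟨ *-identityˡ y ⟨
    1# * y          ≡⟨ cong (_* y) xx⁻¹≡1 ⟨
    x * x⁻¹ * y     ≡⟨ solve 3 (λ x x⁻¹ y → x :* x⁻¹ :* y := x⁻¹ :* (x :* y)) refl x x⁻¹ y ⟩
    x⁻¹ * (x * y)   ≡⟨ cong (x⁻¹ *_) xy≡0 ⟩
    x⁻¹ * 0#        ≡⟨ zeroʳ x⁻¹ ⟩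
    0#              ∎)
    where open ≡-Reasoning

  *≡0⇒≡0 : ∀ {x y} → x ≢ 0# → x * y ≡ 0# → y ≡ 0#
  *≡0⇒≡0 x≢0 xy≡0 with *≡0⇒≡0⊎≡0 xy≡0
  ... | inj₁ x≡0 = ⊥-elim (x≢0 x≡0)
  ... | inj₂ y≡0 = y≡0

  *-≢0 : ∀ {x y} → x ≢ 0# → y ≢ 0# → x * y ≢ 0#
  *-≢0 x≢0 y≢0 xy≡0 = y≢0 (*≡0⇒≡0 x≢0 xy≡0)

  -- If 2 = 0, then x ↦ x + 1 is a fixed-point-free involution of F, which forces q to be even.
  2≢0 : Odd q → 2# ≢ 0#
  2≢0 q-odd 2≡0 = ℕ.0≢1+n (trans (sym (n∣m⇒m%n≡0 q 2 2∣q)) q-odd)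
    where
    successor : Carrier → Carrier
    successor x = x + 1#
    successor-involutive : ∀ x → successor (successor x) ≡ x
    successor-involutive x = begin
      x + 1# + 1#           ≡⟨ solve 2 (λ x o → x :+ o :+ o := x :+ (o :+ (o :+ con (ℤ.+ 0)))) refl x 1# ⟩
      x + 2#                ≡⟨ cong (x +_) 2≡0 ⟩
      x + 0#                ≡⟨ +-identityʳ x ⟩
      x                     ∎
      where open ≡-Reasoning
    successor-fixpointFree : ∀ x → successor x ≢ x
    successor-fixpointFree x x+1≡x = 0≢1 (sym (begin
      1#              ≡⟨ solve 2 (λ x o → o := x :+ o :- x) refl x 1# ⟩
      x + 1# − x      ≡⟨ ≡⇒−≡0 x+1≡x ⟩
      0#              ∎))
      where open ≡-Reasoning
    rank-injective : ∀ {x y} → toℕ (Enum.from x) ≡ toℕ (Enum.from y) → x ≡ y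
    rank-injective {x} {y} eq = trans (sym (Enum.strictlyInverseˡ x))
      (trans (cong Enum.to (toℕ-injective eq)) (Enum.strictlyInverseˡ y))
    2∣q : 2 ∣ q
    2∣q = subst (2 ∣_) length-elements
      (even-length _≟_ elements-unique ∈-elements successor successor-involutive
         (toℕ ∘ Enum.from) rank-injective successor-fixpointFree)

  quadratic : Carrier → Carrier → Carrier → Carrier → Carrier
  quadratic α β γ u = α * u * u + β * u + γ

  quadratic-no-three-roots : ∀ {α β γ u₁ u₂ u₃} → α ≢ 0# →
    quadratic α β γ u₁ ≡ 0# → quadratic α β γ u₂ ≡ 0# → quadratic α β γ u₃ ≡ 0# →
    u₁ ≢ u₂ → u₁ ≢ u₃ → u₂ ≡ u₃
  quadratic-no-three-roots {α} {β} {γ} {u₁} {u₂} {u₃} α≢0 Q₁ Q₂ Q₃ u₁≢u₂ u₁≢u₃ =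
    −≡0⇒≡ (*≡0⇒≡0 α≢0 (begin
      α * (u₂ − u₃)
        ≡⟨ solve 5 (λ α β u₁ u₂ u₃ → α :* (u₂ :- u₃) := α :* (u₁ :+ u₂) :+ β :- (α :* (u₁ :+ u₃) :+ β))
                   refl α β u₁ u₂ u₃ ⟩
      (α * (u₁ + u₂) + β) − (α * (u₁ + u₃) + β)
        ≡⟨ ≡0⇒−≡0 (root-sum Q₁ Q₂ u₁≢u₂) (root-sum Q₁ Q₃ u₁≢u₃) ⟩
      0#
        ∎))
    where
    open ≡-Reasoning
    root-sum : ∀ {u v} → quadratic α β γ u ≡ 0# → quadratic α β γ v ≡ 0# → u ≢ v → α * (u + v) + β ≡ 0#
    root-sum {u} {v} Qu Qv u≢v = *≡0⇒≡0 (λ u−v≡0 → u≢v (−≡0⇒≡ u−v≡0)) (begin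
      (u − v) * (α * (u + v) + β)
        ≡⟨ solve 5 (λ α β γ u v → (u :- v) :* (α :* (u :+ v) :+ β)
                                  := α :* u :* u :+ β :* u :+ γ :- (α :* v :* v :+ β :* v :+ γ))
                   refl α β γ u v ⟩
      quadratic α β γ u − quadratic α β γ v
        ≡⟨ ≡0⇒−≡0 Qu Qv ⟩
      0#
        ∎)

module Space {q : ℕ} (F : FiniteField q) where
  open import Data.Nat as ℕ using (ℕ; _≤_; _<_)
  import Data.Nat.Properties as ℕ
  import Data.Integer as ℤ
  open import Data.List using (List; []; _∷_; length; map; cartesianProduct)
  open import Data.List.Properties using (length-map)
  open import Data.List.Membership.Propositional using (_∈_; find)
  open import Data.List.Relation.Unary.Any using (here)
  open import Data.List.Relation.Unary.All as All using (All; all?)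
  open import Data.List.Relation.Unary.All.Properties using (¬All⇒Any¬)
  open import Data.List.Membership.Propositional.Properties using (∈-map⁻; ∈-cartesianProduct⁺)
  open import Data.List.Relation.Unary.Unique.Propositional using (Unique)
  import Data.List.Relation.Unary.Unique.Propositional.Properties as Unique
  open import Data.Product using (Σ; _×_; _,_; proj₁; proj₂)
  open import Data.Product.Properties using (≡-dec)
  open import Data.Empty using (⊥; ⊥-elim)
  open import Relation.Binary.Definitions using (DecidableEquality)
  open import Relation.Binary.PropositionalEquality
  open import Relation.Nullary using (¬_; Dec; yes; no)
  open Counting

  open FiniteFieldFacts F public

  infixl 6 _−ᵥ_
  infix  7 _∙_
  infix  8 _⨯_
  infix  4 _≟²_ _≟ᵥ_

  _−ᵥ_ : Point → Point → Point
  (x , y , z) −ᵥ (x′ , y′ , z′) = (x − x′ , y − y′ , z − z′)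

  _∙_ : Point → Point → Carrier
  (a , b , c) ∙ (x , y , z) = a * x + b * y + c * z

  _⨯_ : Point → Point → Point
  (a , b , c) ⨯ (x , y , z) = (b * z − c * y , c * x − a * z , a * y − b * x)

  det : Point → Point → Point → Carrier
  det u v w = u ⨯ v ∙ w

  0ᵥ : Point
  0ᵥ = (0# , 0# , 0#)

  components≡0 : ∀ {a b c} → (a , b , c) ≡ 0ᵥ → a ≡ 0# × b ≡ 0# × c ≡ 0#
  components≡0 refl = refl , refl , refl

  dist : Point → Point → Carrier
  dist e p = (p −ᵥ e) ∙ (p −ᵥ e)

  first second third : Point → Carrier
  first  (x , _ , _) = x
  second (_ , y , _) = y
  third  (_ , _ , z) = z

  _≟²_ : DecidableEquality (Carrier × Carrier)
  _≟²_ = ≡-dec _≟_ _≟_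

  _≟ᵥ_ : DecidableEquality Point
  _≟ᵥ_ = ≡-dec _≟_ _≟²_

  pairs : List (Carrier × Carrier)
  pairs = cartesianProduct elements elements

  points : List Point
  points = cartesianProduct elements pairs

  ∈-pairs : ∀ xy → xy ∈ pairs
  ∈-pairs (x , y) = ∈-cartesianProduct⁺ (∈-elements x) (∈-elements y)

  pairs-unique : Unique pairs
  pairs-unique = Unique.cartesianProduct⁺ elements-unique elements-unique

  points-unique : Unique points
  points-unique = Unique.cartesianProduct⁺ elements-unique pairs-unique

  length-pairs : length pairs ≡ q ℕ.* q
  length-pairs = trans (length-cartesianProduct elements elements)
                       (cong₂ ℕ._*_ length-elements length-elements)

  length-points : length points ≡ q ℕ.* (q ℕ.* q)
  length-points = trans (length-cartesianProduct elements pairs)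
                        (cong₂ ℕ._*_ length-elements length-pairs)

  ∙-distrib-−ᵥ : ∀ n p p′ → n ∙ (p −ᵥ p′) ≡ n ∙ p − n ∙ p′
  ∙-distrib-−ᵥ (a , b , c) (x , y , z) (x′ , y′ , z′) = solve 9
    (λ a b c x y z x′ y′ z′ → a :* (x :- x′) :+ b :* (y :- y′) :+ c :* (z :- z′)
                              := a :* x :+ b :* y :+ c :* z :- (a :* x′ :+ b :* y′ :+ c :* z′))
    refl a b c x y z x′ y′ z′

  record CoordinateSwap : Set where
    field
      apply         : Point → Point
      involutive    : ∀ p → apply (apply p) ≡ p
      ∙-invariant   : ∀ u v → apply u ∙ apply v ≡ u ∙ v
      −ᵥ-homo       : ∀ u v → apply (u −ᵥ v) ≡ apply u −ᵥ apply v

    injective : ∀ {u v} → apply u ≡ apply v → u ≡ v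
    injective {u} {v} eq = trans (sym (involutive u)) (trans (cong apply eq) (involutive v))

    dist-invariant : ∀ e p → dist (apply e) (apply p) ≡ dist e p
    dist-invariant e p = begin
      (apply p −ᵥ apply e) ∙ (apply p −ᵥ apply e)   ≡⟨ cong (λ v → v ∙ v) (−ᵥ-homo p e) ⟨
      apply (p −ᵥ e) ∙ apply (p −ᵥ e)               ≡⟨ ∙-invariant (p −ᵥ e) (p −ᵥ e) ⟩
      (p −ᵥ e) ∙ (p −ᵥ e)                           ∎
      where open ≡-Reasoning

  open CoordinateSwap

  id-swap : CoordinateSwap
  id-swap = record
    { apply = λ p → p ; involutive = λ _ → refl ; ∙-invariant = λ _ _ → refl ; −ᵥ-homo = λ _ _ → refl }

  swap₁₂ swap₁₃ swap₂₃ : CoordinateSwap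
  swap₁₂ = record
    { apply       = λ { (x , y , z) → (y , x , z) }
    ; involutive  = λ _ → refl
    ; ∙-invariant = λ { (a , b , c) (x , y , z) → solve 6
        (λ a b c x y z → b :* y :+ a :* x :+ c :* z := a :* x :+ b :* y :+ c :* z) refl a b c x y z }
    ; −ᵥ-homo     = λ _ _ → refl
    }
  swap₁₃ = record
    { apply       = λ { (x , y , z) → (z , y , x) }
    ; involutive  = λ _ → refl
    ; ∙-invariant = λ { (a , b , c) (x , y , z) → solve 6
        (λ a b c x y z → c :* z :+ b :* y :+ a :* x := a :* x :+ b :* y :+ c :* z) refl a b c x y z }
    ; −ᵥ-homo     = λ _ _ → refl
    }
  swap₂₃ = record
    { apply       = λ { (x , y , z) → (x , z , y) }
    ; involutive  = λ _ → refl
    ; ∙-invariant = λ { (a , b , c) (x , y , z) → solve 6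
        (λ a b c x y z → a :* x :+ c :* z :+ b :* y := a :* x :+ b :* y :+ c :* z) refl a b c x y z }
    ; −ᵥ-homo     = λ _ _ → refl
    }

  transport : ∀ σ {S} {P Q : Point → Set} → Unique S → (∀ {p} → P p → Q (apply σ p)) →
              (∀ {p} → p ∈ S → P p) →
              Σ (List Point) λ S′ → Unique S′ × (∀ {p} → p ∈ S′ → Q p) × length S′ ≡ length S
  transport σ {S} !S P⇒Q∘σ P-on-S =
    map (apply σ) S , Unique.map⁺ (injective σ) !S , Q-on-map , length-map (apply σ) S
    where
    Q-on-map : ∀ {p} → p ∈ map (apply σ) S → _
    Q-on-map p∈ with ∈-map⁻ (apply σ) p∈
    ... | p′ , p′∈ , refl = P⇒Q∘σ (P-on-S p′∈)

  -- Centres equidistant from two points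

  separate : ∀ {p p′} → p ≢ p′ → Σ CoordinateSwap λ σ → third (apply σ p) ≢ third (apply σ p′)
  separate {x , y , z} {x′ , y′ , z′} p≢p′ with z ≟ z′ | y ≟ y′ | x ≟ x′
  ... | no z≢z′  | _        | _        = id-swap , z≢z′
  ... | yes _    | no y≢y′  | _        = swap₂₃ , y≢y′
  ... | yes _    | yes _    | no x≢x′  = swap₁₃ , x≢x′
  ... | yes refl | yes refl | yes refl = ⊥-elim (p≢p′ refl)

  bisector-identity : ∀ a b c c′ x y z x′ y′ z′ → 2# * ((z − z′) * (c − c′)) ≡
    (dist (a , b , c′) (x , y , z) − dist (a , b , c′) (x′ , y′ , z′))
      − (dist (a , b , c) (x , y , z) − dist (a , b , c) (x′ , y′ , z′))
  bisector-identity = solve 10 (λ a b c c′ x y z x′ y′ z′ →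
    con (ℤ.+ 2) :* ((z :- z′) :* (c :- c′)) :=
      ((x :- a) :* (x :- a) :+ (y :- b) :* (y :- b) :+ (z :- c′) :* (z :- c′))
        :- ((x′ :- a) :* (x′ :- a) :+ (y′ :- b) :* (y′ :- b) :+ (z′ :- c′) :* (z′ :- c′))
      :- ((x :- a) :* (x :- a) :+ (y :- b) :* (y :- b) :+ (z :- c) :* (z :- c)
        :- ((x′ :- a) :* (x′ :- a) :+ (y′ :- b) :* (y′ :- b) :+ (z′ :- c) :* (z′ :- c))))
    refl

  equidistant-length≤-separated : ∀ {p p′ S} → 2# ≢ 0# → third p ≢ third p′ → Unique S →
                                  (∀ {e} → e ∈ S → dist e p ≡ dist e p′) → length S ≤ q ℕ.* q
  equidistant-length≤-separated {x , y , z} {x′ , y′ , z′} {S} 2≢0 z≢z′ !S equidistant =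
    subst (length S ≤_) (trans (ℕ.*-identityʳ _) length-pairs)
      (length≤fibres _≟²_ S first-two 1 pairs-unique (λ e → ∈-pairs (first-two e)) fibre≤1)
    where
    first-two : Point → Carrier × Carrier
    first-two (a , b , _) = (a , b)
    same-column : ∀ {e e′} → e ∈ S → e′ ∈ S → first-two e ≡ first-two e′ → e ≡ e′
    same-column {a , b , c} {.a , .b , c′} e∈ e′∈ refl =
      cong (λ c → a , b , c) (−≡0⇒≡ (*≡0⇒≡0 (λ z−z′≡0 → z≢z′ (−≡0⇒≡ z−z′≡0)) (*≡0⇒≡0 2≢0 (begin
        2# * ((z − z′) * (c − c′))   ≡⟨ bisector-identity a b c c′ x y z x′ y′ z′ ⟩
        _ − _                       ≡⟨ cong₂ _−_ (≡⇒−≡0 (equidistant e′∈)) (≡⇒−≡0 (equidistant e∈)) ⟩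
        0# − 0#                     ≡⟨ ≡⇒−≡0 refl ⟩
        0#                          ∎))))
      where open ≡-Reasoning
    fibre≤1 : ∀ k → ∑[ e ∈ S ] 𝟙 (first-two e ≟² k) ≤ 1
    fibre≤1 k = count≤1 (λ e → first-two e ≟² k) S !S
      (λ e∈ e′∈ e↦k e′↦k → same-column e∈ e′∈ (trans e↦k (sym e′↦k)))

  equidistant-length≤ : ∀ {p p′ S} → 2# ≢ 0# → p ≢ p′ → Unique S →
                        (∀ {e} → e ∈ S → dist e p ≡ dist e p′) → length S ≤ q ℕ.* q
  equidistant-length≤ {p} {p′} 2≢0 p≢p′ !S equidistant =
    let σ , σp₃≢σp′₃ = separate p≢p′
        S′ , !S′ , equidistant′ , length-S′ = transport σ !S (equidistant-swapped σ) equidistant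
    in subst (_≤ q ℕ.* q) length-S′ (equidistant-length≤-separated 2≢0 σp₃≢σp′₃ !S′ equidistant′)
    where
    equidistant-swapped : ∀ σ {e} → dist e p ≡ dist e p′ →
                          dist (apply σ e) (apply σ p) ≡ dist (apply σ e) (apply σ p′)
    equidistant-swapped σ {e} eq = trans (dist-invariant σ e p) (trans eq (sym (dist-invariant σ e p′)))

  -- Plane sections of spheres

  0²+x²≡x² : ∀ x → 0# * 0# + x * x ≡ x * x
  0²+x²≡x² = solve 1 (λ x → con (ℤ.+ 0) :* con (ℤ.+ 0) :+ x :* x := x :* x) refl

  0²+x²≢0 : ∀ {x} → x ≢ 0# → 0# * 0# + x * x ≢ 0#
  0²+x²≢0 {x} x≢0 eq = *-≢0 x≢0 x≢0 (trans (sym (0²+x²≡x² x)) eq)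

  module PlaneSphereSection (n₁ n₂ n₃ d e₁ e₂ e₃ r : Carrier) where

    α : Carrier
    α = n₂ * n₂ + n₃ * n₃

    K β γ : Carrier → Carrier
    K s = d − n₁ * s − n₃ * e₃
    β s = - (2# * (n₃ * n₃ * e₂ + n₂ * K s))
    γ s = n₃ * n₃ * e₂ * e₂ + K s * K s − n₃ * n₃ * (r − (s − e₁) * (s − e₁))

    -- n₃ w − n₃ e₃ = K s − n₂ u + P with P the plane defect, so n₃² times the sphere defect is the
    -- quadratic plus a multiple of P.
    section-identity : ∀ s u w → quadratic α (β s) (γ s) u ≡
      n₃ * n₃ * (dist (e₁ , e₂ , e₃) (s , u , w) − r)
        − ((n₁ , n₂ , n₃) ∙ (s , u , w) − d) * (2# * (K s − n₂ * u) + ((n₁ , n₂ , n₃) ∙ (s , u , w) − d))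
    section-identity s u w = solve 11 (λ s u w n₁ n₂ n₃ e₁ e₂ e₃ d r →
      let K = d :- n₁ :* s :- n₃ :* e₃
          P = n₁ :* s :+ n₂ :* u :+ n₃ :* w :- d
      in (n₂ :* n₂ :+ n₃ :* n₃) :* u :* u
           :+ (:- (con (ℤ.+ 2) :* (n₃ :* n₃ :* e₂ :+ n₂ :* K))) :* u
           :+ (n₃ :* n₃ :* e₂ :* e₂ :+ K :* K :- n₃ :* n₃ :* (r :- (s :- e₁) :* (s :- e₁)))
         := n₃ :* n₃ :* ((s :- e₁) :* (s :- e₁) :+ (u :- e₂) :* (u :- e₂) :+ (w :- e₃) :* (w :- e₃) :- r)
              :- P :* (con (ℤ.+ 2) :* (K :- n₂ :* u) :+ P))
      refl s u w n₁ n₂ n₃ e₁ e₂ e₃ d r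

    section-root : ∀ {s u w} → OnPlane n₁ n₂ n₃ d (s , u , w) → OnSphere (e₁ , e₂ , e₃) r (s , u , w) →
                   quadratic α (β s) (γ s) u ≡ 0#
    section-root {s} {u} {w} on-plane on-sphere = begin
      quadratic α (β s) (γ s) u    ≡⟨ section-identity s u w ⟩
      n₃ * n₃ * (dist _ _ − r) − (_ − d) * (2# * (K s − n₂ * u) + (_ − d))
                                   ≡⟨ cong₂ (λ E P → n₃ * n₃ * E − P * (2# * (K s − n₂ * u) + P))
                                        (≡⇒−≡0 on-sphere) (≡⇒−≡0 on-plane) ⟩
      n₃ * n₃ * 0# − 0# * (2# * (K s − n₂ * u) + 0#)
                                   ≡⟨ solve 4 (λ n₃ k n₂ u →
                                        n₃ :* n₃ :* con (ℤ.+ 0)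
                                          :- con (ℤ.+ 0) :* (con (ℤ.+ 2) :* (k :- n₂ :* u) :+ con (ℤ.+ 0))
                                        := con (ℤ.+ 0)) refl n₃ (K s) n₂ u ⟩
      0#                           ∎
      where open ≡-Reasoning

    plane-determines-third : n₃ ≢ 0# → ∀ {s u w w′} →
                             OnPlane n₁ n₂ n₃ d (s , u , w) → OnPlane n₁ n₂ n₃ d (s , u , w′) → w ≡ w′
    plane-determines-third n₃≢0 {s} {u} {w} {w′} on-plane on-plane′ = −≡0⇒≡ (*≡0⇒≡0 n₃≢0 (begin
      n₃ * (w − w′)                ≡⟨ solve 8 (λ n₁ n₂ n₃ s u w w′ d →
                                        n₃ :* (w :- w′)
                                        := n₁ :* s :+ n₂ :* u :+ n₃ :* w :- d :- (n₁ :* s :+ n₂ :* u :+ n₃ :* w′ :- d))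
                                        refl n₁ n₂ n₃ s u w w′ d ⟩
      (_ − d) − (_ − d)            ≡⟨ ≡0⇒−≡0 (≡⇒−≡0 on-plane) (≡⇒−≡0 on-plane′) ⟩
      0#                           ∎))
      where open ≡-Reasoning

  -- Over each value s of the first coordinate such a plane is the line with direction (0 , n₃ , − n₂),
  -- which is not isotropic, so it meets a sphere at most twice.
  Canonical : Point → Set
  Canonical (_ , n₂ , n₃) = n₃ ≢ 0# × n₂ * n₂ + n₃ * n₃ ≢ 0#

  plane∩sphere-length≤-canonical : ∀ {n d e r S} → Canonical n → Unique S →
    (∀ {p} → p ∈ S → n ∙ p ≡ d × dist e p ≡ r) → length S ≤ q ℕ.* 2
  plane∩sphere-length≤-canonical {n₁ , n₂ , n₃} {d} {e₁ , e₂ , e₃} {r} {S} (n₃≢0 , α≢0) !S on =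
    subst (length S ≤_) (cong (ℕ._* 2) length-elements)
      (length≤fibres _≟_ S first 2 elements-unique (λ p → ∈-elements (first p)) fibre≤2)
    where
    open PlaneSphereSection n₁ n₂ n₃ d e₁ e₂ e₃ r
    root : ∀ {p} → p ∈ S → quadratic α (β (first p)) (γ (first p)) (second p) ≡ 0#
    root {_ , _ , _} p∈ = section-root (proj₁ (on p∈)) (proj₂ (on p∈))
    same-second : ∀ {s u w u′ w′} → (s , u , w) ∈ S → (s , u′ , w′) ∈ S → u ≡ u′ → (s , u , w) ≡ (s , u′ , w′)
    same-second {s} p∈ p′∈ refl =
      cong (λ w → s , _ , w) (plane-determines-third n₃≢0 (proj₁ (on p∈)) (proj₁ (on p′∈)))
    fibre≤2 : ∀ s → ∑[ p ∈ S ] 𝟙 (first p ≟ s) ≤ 2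
    fibre≤2 s = count≤2 (λ p → first p ≟ s) _≟ᵥ_ S !S no-three
      where
      no-three : ∀ {p₁ p₂ p₃} → p₁ ∈ S → p₂ ∈ S → p₃ ∈ S → first p₁ ≡ s → first p₂ ≡ s → first p₃ ≡ s →
                 p₁ ≢ p₂ → p₁ ≢ p₃ → p₂ ≢ p₃ → ⊥
      no-three {.s , _ , _} {.s , _ , _} {.s , _ , _} p₁∈ p₂∈ p₃∈ refl refl refl p₁≢p₂ p₁≢p₃ p₂≢p₃ =
        p₂≢p₃ (same-second p₂∈ p₃∈ (quadratic-no-three-roots α≢0 (root p₁∈) (root p₂∈) (root p₃∈)
          (λ u₁≡u₂ → p₁≢p₂ (same-second p₁∈ p₂∈ u₁≡u₂)) (λ u₁≡u₃ → p₁≢p₃ (same-second p₁∈ p₃∈ u₁≡u₃))))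

  private
    canonicalise-flat : ∀ {n₁ n₂} → (n₁ , n₂ , 0#) ≢ 0ᵥ →
                        Σ CoordinateSwap λ σ → Canonical (apply σ (n₁ , n₂ , 0#))
    canonicalise-flat {n₁} {n₂} n≢0 with n₂ ≟ 0#
    ... | no  n₂≢0 = swap₂₃ , n₂≢0 , 0²+x²≢0 n₂≢0
    ... | yes refl with n₁ ≟ 0#
    ...   | no  n₁≢0 = swap₁₃ , n₁≢0 , 0²+x²≢0 n₁≢0
    ...   | yes refl = ⊥-elim (n≢0 refl)

    canonicalise-steep : 2# ≢ 0# → ∀ {n₁ n₂ n₃} → n₃ ≢ 0# →
                         Σ CoordinateSwap λ σ → Canonical (apply σ (n₁ , n₂ , n₃))
    canonicalise-steep 2≢0 {n₁} {n₂} {n₃} n₃≢0 with (n₂ * n₂ + n₃ * n₃) ≟ 0#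
    ... | no  n₂²+n₃²≢0 = id-swap , n₃≢0 , n₂²+n₃²≢0
    ... | yes n₂²+n₃²≡0 with (n₁ * n₁ + n₃ * n₃) ≟ 0#
    ...   | no  n₁²+n₃²≢0 = swap₁₂ , n₃≢0 , n₁²+n₃²≢0
    ...   | yes n₁²+n₃²≡0 = swap₁₃ , n₁≢0 , n₂²+n₁²≢0
      where
      n₃²≢0 : n₃ * n₃ ≢ 0#
      n₃²≢0 = *-≢0 n₃≢0 n₃≢0
      n₁≢0 : n₁ ≢ 0#
      n₁≢0 n₁≡0 = n₃²≢0 (trans (sym (0²+x²≡x² n₃)) (subst (λ t → t * t + n₃ * n₃ ≡ 0#) n₁≡0 n₁²+n₃²≡0))
      n₂²+n₁²≢0 : n₂ * n₂ + n₁ * n₁ ≢ 0#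
      n₂²+n₁²≢0 n₂²+n₁²≡0 = *-≢0 2≢0 n₃²≢0 (begin
        2# * (n₃ * n₃)
          ≡⟨ solve 3 (λ n₁ n₂ n₃ → con (ℤ.+ 2) :* (n₃ :* n₃)
                                    := n₂ :* n₂ :+ n₃ :* n₃ :+ (n₁ :* n₁ :+ n₃ :* n₃) :- (n₂ :* n₂ :+ n₁ :* n₁))
                     refl n₁ n₂ n₃ ⟩
        (n₂ * n₂ + n₃ * n₃) + (n₁ * n₁ + n₃ * n₃) − (n₂ * n₂ + n₁ * n₁)
          ≡⟨ cong₂ (λ a b → a + b − (n₂ * n₂ + n₁ * n₁)) n₂²+n₃²≡0 n₁²+n₃²≡0 ⟩
        0# + 0# − (n₂ * n₂ + n₁ * n₁)
          ≡⟨ ≡0⇒−≡0 (+-identityˡ 0#) n₂²+n₁²≡0 ⟩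
        0#
          ∎)
        where open ≡-Reasoning

  canonicalise : 2# ≢ 0# → ∀ {n} → n ≢ 0ᵥ → Σ CoordinateSwap λ σ → Canonical (apply σ n)
  canonicalise 2≢0 {n₁ , n₂ , n₃} n≢0 with n₃ ≟ 0#
  ... | yes refl  = canonicalise-flat n≢0
  ... | no  n₃≢0 = canonicalise-steep 2≢0 n₃≢0

  plane∩sphere-length≤ : ∀ {n d e r S} → 2# ≢ 0# → n ≢ 0ᵥ → Unique S →
    (∀ {p} → p ∈ S → n ∙ p ≡ d × dist e p ≡ r) → length S ≤ q ℕ.* 2
  plane∩sphere-length≤ {n} {d} {e} {r} 2≢0 n≢0 !S on =
    let σ , canonical = canonicalise 2≢0 n≢0
        S′ , !S′ , on′ , length-S′ = transport σ !S (on-swapped σ) on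
    in subst (_≤ q ℕ.* 2) length-S′ (plane∩sphere-length≤-canonical canonical !S′ on′)
    where
    on-swapped : ∀ σ {p} → n ∙ p ≡ d × dist e p ≡ r →
                 apply σ n ∙ apply σ p ≡ d × dist (apply σ e) (apply σ p) ≡ r
    on-swapped σ {p} (plane , sphere) = trans (∙-invariant σ n p) plane , trans (dist-invariant σ e p) sphere

  -- Coplanarity

  ∙-−ᵥ≡0⇒≡ : ∀ {n p p′} → n ∙ (p −ᵥ p′) ≡ 0# → n ∙ p ≡ n ∙ p′
  ∙-−ᵥ≡0⇒≡ {n} {p} {p′} eq = −≡0⇒≡ (trans (sym (∙-distrib-−ᵥ n p p′)) eq)

  ≡⇒∙-−ᵥ≡0 : ∀ {n p p′} → n ∙ p ≡ n ∙ p′ → n ∙ (p −ᵥ p′) ≡ 0#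
  ≡⇒∙-−ᵥ≡0 {n} {p} {p′} eq = trans (∙-distrib-−ᵥ n p p′) (≡⇒−≡0 eq)

  det-cofactors₁ : ∀ u v w n →
    det u v w * first n ≡ (n ∙ u) * first (v ⨯ w) + (n ∙ v) * first (w ⨯ u) + (n ∙ w) * first (u ⨯ v)
  det-cofactors₁ (x₁ , y₁ , z₁) (x₂ , y₂ , z₂) (x₃ , y₃ , z₃) (a , b , c) = solve 12
    (λ x₁ y₁ z₁ x₂ y₂ z₂ x₃ y₃ z₃ a b c →
      ((y₁ :* z₂ :- z₁ :* y₂) :* x₃ :+ (z₁ :* x₂ :- x₁ :* z₂) :* y₃ :+ (x₁ :* y₂ :- y₁ :* x₂) :* z₃) :* a
      := (a :* x₁ :+ b :* y₁ :+ c :* z₁) :* (y₂ :* z₃ :- z₂ :* y₃)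
         :+ (a :* x₂ :+ b :* y₂ :+ c :* z₂) :* (y₃ :* z₁ :- z₃ :* y₁)
         :+ (a :* x₃ :+ b :* y₃ :+ c :* z₃) :* (y₁ :* z₂ :- z₁ :* y₂))
    refl x₁ y₁ z₁ x₂ y₂ z₂ x₃ y₃ z₃ a b c

  det-cofactors₂ : ∀ u v w n →
    det u v w * second n ≡ (n ∙ u) * second (v ⨯ w) + (n ∙ v) * second (w ⨯ u) + (n ∙ w) * second (u ⨯ v)
  det-cofactors₂ (x₁ , y₁ , z₁) (x₂ , y₂ , z₂) (x₃ , y₃ , z₃) (a , b , c) = solve 12
    (λ x₁ y₁ z₁ x₂ y₂ z₂ x₃ y₃ z₃ a b c →
      ((y₁ :* z₂ :- z₁ :* y₂) :* x₃ :+ (z₁ :* x₂ :- x₁ :* z₂) :* y₃ :+ (x₁ :* y₂ :- y₁ :* x₂) :* z₃) :* b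
      := (a :* x₁ :+ b :* y₁ :+ c :* z₁) :* (z₂ :* x₃ :- x₂ :* z₃)
         :+ (a :* x₂ :+ b :* y₂ :+ c :* z₂) :* (z₃ :* x₁ :- x₃ :* z₁)
         :+ (a :* x₃ :+ b :* y₃ :+ c :* z₃) :* (z₁ :* x₂ :- x₁ :* z₂))
    refl x₁ y₁ z₁ x₂ y₂ z₂ x₃ y₃ z₃ a b c

  det-cofactors₃ : ∀ u v w n →
    det u v w * third n ≡ (n ∙ u) * third (v ⨯ w) + (n ∙ v) * third (w ⨯ u) + (n ∙ w) * third (u ⨯ v)
  det-cofactors₃ (x₁ , y₁ , z₁) (x₂ , y₂ , z₂) (x₃ , y₃ , z₃) (a , b , c) = solve 12
    (λ x₁ y₁ z₁ x₂ y₂ z₂ x₃ y₃ z₃ a b c →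
      ((y₁ :* z₂ :- z₁ :* y₂) :* x₃ :+ (z₁ :* x₂ :- x₁ :* z₂) :* y₃ :+ (x₁ :* y₂ :- y₁ :* x₂) :* z₃) :* c
      := (a :* x₁ :+ b :* y₁ :+ c :* z₁) :* (x₂ :* y₃ :- y₂ :* x₃)
         :+ (a :* x₂ :+ b :* y₂ :+ c :* z₂) :* (x₃ :* y₁ :- y₃ :* x₁)
         :+ (a :* x₃ :+ b :* y₃ :+ c :* z₃) :* (x₁ :* y₂ :- y₁ :* x₂))
    refl x₁ y₁ z₁ x₂ y₂ z₂ x₃ y₃ z₃ a b c

  det≢0⇒orthogonal≡0 : ∀ {u v w n} → det u v w ≢ 0# → n ∙ u ≡ 0# → n ∙ v ≡ 0# → n ∙ w ≡ 0# → n ≡ 0ᵥ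
  det≢0⇒orthogonal≡0 {u} {v} {w} {n} det≢0 n⊥u n⊥v n⊥w = cong₂ _,_ (component (det-cofactors₁ u v w n))
    (cong₂ _,_ (component (det-cofactors₂ u v w n)) (component (det-cofactors₃ u v w n)))
    where
    component : ∀ {t X Y Z} → det u v w * t ≡ (n ∙ u) * X + (n ∙ v) * Y + (n ∙ w) * Z → t ≡ 0#
    component {t} {X} {Y} {Z} eq = *≡0⇒≡0 det≢0 (begin
      det u v w * t
        ≡⟨ eq ⟩
      (n ∙ u) * X + (n ∙ v) * Y + (n ∙ w) * Z
        ≡⟨ cong₂ _+_ (cong₂ _+_ (cong (_* X) n⊥u) (cong (_* Y) n⊥v)) (cong (_* Z) n⊥w) ⟩
      0# * X + 0# * Y + 0# * Z
        ≡⟨ solve 3 (λ X Y Z → con (ℤ.+ 0) :* X :+ con (ℤ.+ 0) :* Y :+ con (ℤ.+ 0) :* Z := con (ℤ.+ 0)) refl X Y Z ⟩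
      0#
        ∎)
      where open ≡-Reasoning

  det≢0⇒¬coplanar : ∀ {p₁ p₂ p₃ p₄} → det (p₂ −ᵥ p₁) (p₃ −ᵥ p₁) (p₄ −ᵥ p₁) ≢ 0# → ¬ Coplanar p₁ p₂ p₃ p₄
  det≢0⇒¬coplanar det≢0 (a , b , c , d , n≢0 , on₁ , on₂ , on₃ , on₄) =
    n≢0 (components≡0 (det≢0⇒orthogonal≡0 det≢0 (relative on₂) (relative on₃) (relative on₄)))
    where
    relative : ∀ {p} → (a , b , c) ∙ p ≡ d → (a , b , c) ∙ (p −ᵥ _) ≡ 0#
    relative on = ≡⇒∙-−ᵥ≡0 (trans on (sym on₁))

  parallel⇒orthogonal : ∀ v b w → v ⨯ w ≡ 0ᵥ → v ⨯ b ∙ w ≡ 0#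
  parallel⇒orthogonal v@(v₁ , v₂ , v₃) b@(b₁ , b₂ , b₃) w@(w₁ , w₂ , w₃) v⨯w≡0 = begin
    v ⨯ b ∙ w        ≡⟨ solve 9 (λ v₁ v₂ v₃ b₁ b₂ b₃ w₁ w₂ w₃ →
                          (v₂ :* b₃ :- v₃ :* b₂) :* w₁ :+ (v₃ :* b₁ :- v₁ :* b₃) :* w₂ :+ (v₁ :* b₂ :- v₂ :* b₁) :* w₃
                          := :- ((v₂ :* w₃ :- v₃ :* w₂) :* b₁ :+ (v₃ :* w₁ :- v₁ :* w₃) :* b₂
                                 :+ (v₁ :* w₂ :- v₂ :* w₁) :* b₃))
                          refl v₁ v₂ v₃ b₁ b₂ b₃ w₁ w₂ w₃ ⟩
    - (v ⨯ w ∙ b)    ≡⟨ cong (λ n → - (n ∙ b)) v⨯w≡0 ⟩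
    - (0ᵥ ∙ b)       ≡⟨ solve 3 (λ b₁ b₂ b₃ →
                            :- (con (ℤ.+ 0) :* b₁ :+ con (ℤ.+ 0) :* b₂ :+ con (ℤ.+ 0) :* b₃) := con (ℤ.+ 0))
                          refl b₁ b₂ b₃ ⟩
    0#               ∎
    where open ≡-Reasoning

  -- ⟦ ℤ.+ 1 ⟧ reduces to 1# + 0#, the value the solver gives to con (ℤ.+ 1).
  unit₁ unit₂ : Point
  unit₁ = (⟦ ℤ.+ 1 ⟧ , 0# , 0#)
  unit₂ = (0# , ⟦ ℤ.+ 1 ⟧ , 0#)

  non-parallel : ∀ {v} → v ≢ 0ᵥ → Σ Point λ b → v ⨯ b ≢ 0ᵥ
  non-parallel {v₁ , v₂ , v₃} v≢0 with v₂ ≟ 0# | v₃ ≟ 0#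
  ... | no v₂≢0  | _        = unit₁ , λ v⨯b≡0 → v₂≢0 (sym (−≡0⇒≡ (begin
    0# − v₂                ≡⟨ solve 2 (λ v₁ v₂ → con (ℤ.+ 0) :- v₂ := v₁ :* con (ℤ.+ 0) :- v₂ :* con (ℤ.+ 1)) refl v₁ v₂ ⟩
    third ((v₁ , v₂ , v₃) ⨯ unit₁)  ≡⟨ proj₂ (proj₂ (components≡0 v⨯b≡0)) ⟩
    0#                     ∎)))
    where open ≡-Reasoning
  ... | yes _    | no v₃≢0  = unit₁ , λ v⨯b≡0 → v₃≢0 (begin
    v₃                     ≡⟨ solve 2 (λ v₁ v₃ → v₃ := v₃ :* con (ℤ.+ 1) :- v₁ :* con (ℤ.+ 0)) refl v₁ v₃ ⟩
    second ((v₁ , v₂ , v₃) ⨯ unit₁) ≡⟨ proj₁ (proj₂ (components≡0 v⨯b≡0)) ⟩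
    0#                     ∎)
    where open ≡-Reasoning
  ... | yes refl | yes refl = unit₂ , λ v⨯b≡0 → v≢0 (cong (λ x → x , 0# , 0#) (begin
    v₁                     ≡⟨ solve 1 (λ v₁ → v₁ := v₁ :* con (ℤ.+ 1) :- con (ℤ.+ 0) :* con (ℤ.+ 0)) refl v₁ ⟩
    third ((v₁ , 0# , 0#) ⨯ unit₂)  ≡⟨ proj₂ (proj₂ (components≡0 v⨯b≡0)) ⟩
    0#                     ∎))
    where open ≡-Reasoning

  unit₁≢0 : unit₁ ≢ 0ᵥ
  unit₁≢0 unit₁≡0 = 0≢1 (sym (trans (sym (+-identityʳ 1#)) (proj₁ (components≡0 unit₁≡0))))

  −ᵥ≢0 : ∀ {p p′} → p ≢ p′ → p −ᵥ p′ ≢ 0ᵥ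
  −ᵥ≢0 {x , y , z} {x′ , y′ , z′} p≢p′ p−p′≡0 with components≡0 p−p′≡0
  ... | x−x′≡0 , y−y′≡0 , z−z′≡0 =
    p≢p′ (cong₂ _,_ (−≡0⇒≡ x−x′≡0) (cong₂ _,_ (−≡0⇒≡ y−y′≡0) (−≡0⇒≡ z−z′≡0)))

  det≟0 : ∀ p₁ p₂ p₃ p₄ → Dec (det (p₂ −ᵥ p₁) (p₃ −ᵥ p₁) (p₄ −ᵥ p₁) ≡ 0#)
  det≟0 p₁ p₂ p₃ p₄ = det (p₂ −ᵥ p₁) (p₃ −ᵥ p₁) (p₄ −ᵥ p₁) ≟ 0#

  Flat : Point → List Point → Set
  Flat p₁ S = All (λ p₂ → All (λ p₃ → All (λ p₄ → det (p₂ −ᵥ p₁) (p₃ −ᵥ p₁) (p₄ −ᵥ p₁) ≡ 0#) S) S) S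

  flat? : ∀ p₁ S → Dec (Flat p₁ S)
  flat? p₁ S = all? (λ p₂ → all? (λ p₃ → all? (det≟0 p₁ p₂ p₃) S) S) S

  flat⇒supporting-plane : ∀ {p₁ S} → Flat p₁ S → Σ Point λ n → n ≢ 0ᵥ × (∀ {p} → p ∈ S → n ∙ p ≡ n ∙ p₁)
  flat⇒supporting-plane {p₁} {S} flat with all? (_≟ᵥ p₁) S
  ... | yes all≡p₁ = unit₁ , unit₁≢0 , λ p∈ → cong (unit₁ ∙_) (All.lookup all≡p₁ p∈)
  ... | no  ¬all≡p₁ with find (¬All⇒Any¬ (_≟ᵥ p₁) S ¬all≡p₁)
  ...   | p₂ , p₂∈ , p₂≢p₁ with all? (λ p₃ → (p₂ −ᵥ p₁) ⨯ (p₃ −ᵥ p₁) ≟ᵥ 0ᵥ) S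
  ...     | yes collinear =
            let b , v⨯b≢0 = non-parallel (−ᵥ≢0 p₂≢p₁)
            in (p₂ −ᵥ p₁) ⨯ b , v⨯b≢0 ,
               λ p∈ → ∙-−ᵥ≡0⇒≡ (parallel⇒orthogonal (p₂ −ᵥ p₁) b _ (All.lookup collinear p∈))
  ...     | no  ¬collinear with find (¬All⇒Any¬ (λ p₃ → (p₂ −ᵥ p₁) ⨯ (p₃ −ᵥ p₁) ≟ᵥ 0ᵥ) S ¬collinear)
  ...       | p₃ , p₃∈ , n≢0 =
            (p₂ −ᵥ p₁) ⨯ (p₃ −ᵥ p₁) , n≢0 ,
            λ p∈ → ∙-−ᵥ≡0⇒≡ (All.lookup (All.lookup (All.lookup flat p₂∈) p₃∈) p∈)

  NonCoplanarQuadruple : List Point → Set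
  NonCoplanarQuadruple S = Σ Point λ p₁ → Σ Point λ p₂ → Σ Point λ p₃ → Σ Point λ p₄ →
    (p₁ ∈ S × p₂ ∈ S × p₃ ∈ S × p₄ ∈ S) × ¬ Coplanar p₁ p₂ p₃ p₄

  ¬flat⇒non-coplanar : ∀ {p₁ S} → p₁ ∈ S → ¬ Flat p₁ S → NonCoplanarQuadruple S
  ¬flat⇒non-coplanar {p₁} {S} p₁∈ ¬flat
    with find (¬All⇒Any¬ (λ p₂ → all? (λ p₃ → all? (det≟0 p₁ p₂ p₃) S) S) S ¬flat)
  ... | p₂ , p₂∈ , ¬flat₂ with find (¬All⇒Any¬ (λ p₃ → all? (det≟0 p₁ p₂ p₃) S) S ¬flat₂)
  ... | p₃ , p₃∈ , ¬flat₃ with find (¬All⇒Any¬ (det≟0 p₁ p₂ p₃) S ¬flat₃)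
  ... | p₄ , p₄∈ , det≢0 = p₁ , p₂ , p₃ , p₄ , (p₁∈ , p₂∈ , p₃∈ , p₄∈) , det≢0⇒¬coplanar det≢0

  large-sphere⇒non-coplanar : ∀ {e r S} → 2# ≢ 0# → Unique S → (∀ {p} → p ∈ S → dist e p ≡ r) →
                              q ℕ.* 2 < length S → NonCoplanarQuadruple S
  large-sphere⇒non-coplanar {S = []}          _   _  _         ()
  large-sphere⇒non-coplanar {S = S@(p₁ ∷ _)} 2≢0 !S on-sphere 2q<|S| with flat? p₁ S
  ... | no  ¬flat = ¬flat⇒non-coplanar (here refl) ¬flat
  ... | yes flat  =
    let n , n≢0 , on-plane = flat⇒supporting-plane flat
    in ⊥-elim (ℕ.<⇒≱ 2q<|S| (plane∩sphere-length≤ 2≢0 n≢0 !S (λ p∈ → on-plane p∈ , on-sphere p∈)))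

module Incidences {q : ℕ} (F : FiniteField q) (𝒫 : List (FiniteField.Point F)) where
  open import Data.Nat as ℕ using (ℕ; _≤_; _<_; _<?_; _*_; _+_)
  open import Data.Nat.Properties hiding (_≟_)
  open import Data.List using (List; length; filter)
  open import Data.List.Membership.Propositional using (_∈_)
  open import Data.List.Membership.Propositional.Properties using (∈-filter⁻)
  open import Data.List.Relation.Unary.All as All using (All)
  open import Data.List.Relation.Unary.Unique.Propositional using (Unique)
  import Data.List.Relation.Unary.Unique.Propositional.Properties as Unique
  open import Data.Product using (Σ; _×_; _,_; proj₁; proj₂)
  open import Relation.Binary.PropositionalEquality
  open import Relation.Nullary using (Dec; yes; no)
  open Counting

  open Space F using (Point; Carrier; 0#; 2#; _≟_; _≟ᵥ_; dist; elements; elements-unique; ∈-elements; length-elements;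
                     points; points-unique; length-points; equidistant-length≤;
                     DeterminedRadius; large-sphere⇒non-coplanar)

  N : ℕ
  N = length 𝒫

  sphereCount : Point → Carrier → ℕ
  sphereCount e r = ∑[ p ∈ 𝒫 ] 𝟙 (dist e p ≟ r)

  energy : Point → ℕ
  energy e = ∑[ r ∈ elements ] (sphereCount e r * sphereCount e r)

  ∑-sphereCount : ∀ e → ∑[ r ∈ elements ] sphereCount e r ≡ N
  ∑-sphereCount e = begin
    ∑[ r ∈ elements ] ∑[ p ∈ 𝒫 ] 𝟙 (dist e p ≟ r)
      ≡⟨ ∑-comm elements 𝒫 _ ⟩
    ∑[ p ∈ 𝒫 ] ∑[ r ∈ elements ] 𝟙 (dist e p ≟ r)
      ≡⟨ ∑-cong 𝒫 (λ p _ → count-≡ _≟_ elements elements-unique (∈-elements (dist e p))) ⟩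
    ∑[ _ ∈ 𝒫 ] 1
      ≡⟨ length≡∑1 𝒫 ⟨
    N
      ∎
    where open ≡-Reasoning

  energy≡equidistant-pairs : ∀ e → energy e ≡ ∑[ p ∈ 𝒫 ] ∑[ p′ ∈ 𝒫 ] 𝟙 (dist e p′ ≟ dist e p)
  energy≡equidistant-pairs e = begin
    ∑[ r ∈ elements ] (sphereCount e r * sphereCount e r)
      ≡⟨ ∑-cong elements (λ r _ → ∑*∑ 𝒫 𝒫 (λ p → 𝟙 (dist e p ≟ r)) (λ p′ → 𝟙 (dist e p′ ≟ r))) ⟩
    ∑[ r ∈ elements ] ∑[ p ∈ 𝒫 ] ∑[ p′ ∈ 𝒫 ] (𝟙 (dist e p ≟ r) * 𝟙 (dist e p′ ≟ r))
      ≡⟨ ∑-comm elements 𝒫 _ ⟩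
    ∑[ p ∈ 𝒫 ] ∑[ r ∈ elements ] ∑[ p′ ∈ 𝒫 ] (𝟙 (dist e p ≟ r) * 𝟙 (dist e p′ ≟ r))
      ≡⟨ ∑-cong 𝒫 (λ p _ → ∑-comm elements 𝒫 _) ⟩
    ∑[ p ∈ 𝒫 ] ∑[ p′ ∈ 𝒫 ] ∑[ r ∈ elements ] (𝟙 (dist e p ≟ r) * 𝟙 (dist e p′ ≟ r))
      ≡⟨ ∑-cong 𝒫 (λ p _ → ∑-cong 𝒫 (λ p′ _ →
           ∑-select _≟_ elements (λ r → 𝟙 (dist e p′ ≟ r)) elements-unique (∈-elements (dist e p)))) ⟩
    ∑[ p ∈ 𝒫 ] ∑[ p′ ∈ 𝒫 ] 𝟙 (dist e p′ ≟ dist e p)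
      ∎
    where open ≡-Reasoning

  module WithUniquePoints (2≢0 : 2# ≢ 0#) (!𝒫 : Unique 𝒫) where

    equidistant-count≤ : ∀ p p′ →
      ∑[ e ∈ points ] 𝟙 (dist e p′ ≟ dist e p) ≤ q * (q * q) * 𝟙 (p′ ≟ᵥ p) + q * q
    equidistant-count≤ p p′ with p′ ≟ᵥ p
    ... | yes _ = begin
      ∑[ e ∈ points ] 𝟙 (dist e p′ ≟ dist e p)   ≤⟨ ∑-≤-length* points 1 (λ e _ → 𝟙≤1 _) ⟩
      length points * 1                         ≡⟨ cong (_* 1) length-points ⟩
      q * (q * q) * 1                           ≤⟨ m≤m+n _ (q * q) ⟩
      q * (q * q) * 1 + q * q                   ∎
      where open ≤-Reasoning
    ... | no p′≢p = begin
      ∑[ e ∈ points ] 𝟙 (dist e p′ ≟ dist e p)   ≡⟨ length-filter equidistant? points ⟨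
      length (filter equidistant? points)        ≤⟨ equidistant-length≤ 2≢0 p′≢p
                                                      (Unique.filter⁺ equidistant? points-unique)
                                                      (λ e∈ → proj₂ (∈-filter⁻ equidistant? {xs = points} e∈)) ⟩
      q * q                                      ≤⟨ m≤n+m (q * q) _ ⟩
      q * (q * q) * 0 + q * q                    ∎
      where
      open ≤-Reasoning
      equidistant? : ∀ e → Dec (dist e p′ ≡ dist e p)
      equidistant? e = dist e p′ ≟ dist e p

    ∑-energy≤ : ∑[ e ∈ points ] energy e ≤ N * (q * (q * q) + N * (q * q))
    ∑-energy≤ = begin
      ∑[ e ∈ points ] energy e
        ≡⟨ ∑-cong points (λ e _ → energy≡equidistant-pairs e) ⟩
      ∑[ e ∈ points ] ∑[ p ∈ 𝒫 ] ∑[ p′ ∈ 𝒫 ] 𝟙 (dist e p′ ≟ dist e p)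
        ≡⟨ ∑-comm points 𝒫 _ ⟩
      ∑[ p ∈ 𝒫 ] ∑[ e ∈ points ] ∑[ p′ ∈ 𝒫 ] 𝟙 (dist e p′ ≟ dist e p)
        ≡⟨ ∑-cong 𝒫 (λ p _ → ∑-comm points 𝒫 _) ⟩
      ∑[ p ∈ 𝒫 ] ∑[ p′ ∈ 𝒫 ] ∑[ e ∈ points ] 𝟙 (dist e p′ ≟ dist e p)
        ≤⟨ ∑-mono-≤ 𝒫 (λ p _ → ∑-mono-≤ 𝒫 (λ p′ _ → equidistant-count≤ p p′)) ⟩
      ∑[ p ∈ 𝒫 ] ∑[ p′ ∈ 𝒫 ] (q * (q * q) * 𝟙 (p′ ≟ᵥ p) + q * q)
        ≡⟨ ∑-cong 𝒫 (λ p _ →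
             trans (∑-distrib-+ 𝒫 _ _) (cong₂ _+_ (∑-*ˡ 𝒫 (q * (q * q)) _) (∑-const 𝒫 (q * q)))) ⟩
      ∑[ p ∈ 𝒫 ] (q * (q * q) * ∑[ p′ ∈ 𝒫 ] 𝟙 (p′ ≟ᵥ p) + N * (q * q))
        ≤⟨ ∑-mono-≤ 𝒫 (λ p _ → +-monoˡ-≤ (N * (q * q)) (*-monoʳ-≤ (q * (q * q)) (multiplicity≤1 p))) ⟩
      ∑[ _ ∈ 𝒫 ] (q * (q * q) * 1 + N * (q * q))
        ≡⟨ ∑-const 𝒫 _ ⟩
      N * (q * (q * q) * 1 + N * (q * q))
        ≡⟨ cong (λ t → N * (t + N * (q * q))) (*-identityʳ _) ⟩
      N * (q * (q * q) + N * (q * q))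
        ∎
      where
      open ≤-Reasoning
      multiplicity≤1 : ∀ p → ∑[ p′ ∈ 𝒫 ] 𝟙 (p′ ≟ᵥ p) ≤ 1
      multiplicity≤1 p = count≤1 (_≟ᵥ p) 𝒫 !𝒫 (λ _ _ p′≡p p″≡p → trans p′≡p (sym p″≡p))

    low-energy-centre : 0 < q → Σ Point λ e → q * (q * q) * energy e ≤ N * (q * (q * q) + N * (q * q))
    low-energy-centre 0<q =
      let e , average = below-average energy points
                          (subst (0 <_) (sym length-points) (*-mono-< 0<q (*-mono-< 0<q 0<q)))
      in e , ≤-trans (subst (λ m → m * energy e ≤ ∑ points energy) length-points average) ∑-energy≤

    module _ (e : Point) where

      rich? : ∀ r → Dec (q * 2 < sphereCount e r)
      rich? r = q * 2 <? sphereCount e r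

      richRadii : List Carrier
      richRadii = filter rich? elements

      richRadii-unique : Unique richRadii
      richRadii-unique = Unique.filter⁺ rich? elements-unique

      rich⇒determined : ∀ {r} → q * 2 < sphereCount e r → DeterminedRadius 𝒫 r
      rich⇒determined {r} rich =
        let p₁ , p₂ , p₃ , p₄ , (p₁∈ , p₂∈ , p₃∈ , p₄∈) , non-coplanar =
              large-sphere⇒non-coplanar 2≢0 (Unique.filter⁺ on-sphere? !𝒫) on-sphere
                (subst (q * 2 <_) (sym (length-filter on-sphere? 𝒫)) rich)
        in e , p₁ , p₂ , p₃ , p₄ , (in-𝒫 p₁∈ , in-𝒫 p₂∈ , in-𝒫 p₃∈ , in-𝒫 p₄∈) , non-coplanar ,
           (on-sphere p₁∈ , on-sphere p₂∈ , on-sphere p₃∈ , on-sphere p₄∈)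
        where
        on-sphere? : ∀ p → Dec (dist e p ≡ r)
        on-sphere? p = dist e p ≟ r
        in-𝒫 : ∀ {p} → p ∈ filter on-sphere? 𝒫 → p ∈ 𝒫
        in-𝒫 p∈ = proj₁ (∈-filter⁻ on-sphere? {xs = 𝒫} p∈)
        on-sphere : ∀ {p} → p ∈ filter on-sphere? 𝒫 → dist e p ≡ r
        on-sphere p∈ = proj₂ (∈-filter⁻ on-sphere? {xs = 𝒫} p∈)

      richRadii-determined : All (DeterminedRadius 𝒫) richRadii
      richRadii-determined = All.tabulate (λ r∈ → rich⇒determined (proj₂ (∈-filter⁻ rich? {xs = elements} r∈)))

      richIncidences : ℕ
      richIncidences = ∑ richRadii (sphereCount e)

      N≤richIncidences+2q² : N ≤ richIncidences + q * (q * 2)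
      N≤richIncidences+2q² = begin
        N
          ≡⟨ ∑-sphereCount e ⟨
        ∑[ r ∈ elements ] sphereCount e r
          ≤⟨ ∑-mono-≤ elements (λ r _ → split r) ⟩
        ∑[ r ∈ elements ] (𝟙 (rich? r) * sphereCount e r + q * 2)
          ≡⟨ ∑-distrib-+ elements _ _ ⟩
        ∑[ r ∈ elements ] (𝟙 (rich? r) * sphereCount e r) + ∑[ _ ∈ elements ] (q * 2)
          ≡⟨ cong₂ _+_ (sym (∑-filter rich? elements (sphereCount e))) (∑-const elements (q * 2)) ⟩
        richIncidences + length elements * (q * 2)
          ≡⟨ cong (λ n → richIncidences + n * (q * 2)) length-elements ⟩
        richIncidences + q * (q * 2)
          ∎
        where
        open ≤-Reasoning
        split : ∀ r → sphereCount e r ≤ 𝟙 (rich? r) * sphereCount e r + q * 2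
        split r with rich? r
        ... | yes _    = subst (λ n → sphereCount e r ≤ n + q * 2) (sym (+-identityʳ _)) (m≤m+n _ (q * 2))
        ... | no  poor = ≮⇒≥ poor

      richIncidences²≤ : richIncidences * richIncidences ≤ length richRadii * energy e
      richIncidences²≤ = ≤-trans (cauchy-schwarz richRadii (sphereCount e))
        (*-monoʳ-≤ (length richRadii) (∑-filter-≤ rich? elements (λ r → sphereCount e r * sphereCount e r)))

    many-rich-radii : 0 < q → N ≡ 8 * q * q → Σ Point λ e → q ≤ 9 * length (richRadii e)
    many-rich-radii 0<q N≡8q² =
      let e , low-energy = low-energy-centre 0<q
      in e , ≤-trans (radii-arithmetic {k = length (richRadii e)} 0<q
                        (subst (_≤ richIncidences e + q * (q * 2)) N≡8q² (N≤richIncidences+2q² e))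
                        (richIncidences²≤ e)
                        (subst (λ N → q * (q * q) * energy e ≤ N * (q * (q * q) + N * (q * q))) N≡8q² low-energy))
                     (*-monoˡ-≤ (length (richRadii e)) {2} {9} (ℕ.s≤s (ℕ.s≤s ℕ.z≤n)))

theorem1p14 : (q : ℕ) → IsPrimePower q → Odd q → (F : FiniteField q) →
    let open FiniteField F in
    (𝒫 : List Point) → Unique 𝒫 → length 𝒫 ≡ 8 *ℕ q *ℕ q →
    Σ (List Carrier) λ radii →
      Unique radii × All (DeterminedRadius 𝒫) radii × q ≤ 9 *ℕ length radii
theorem1p14 q _ q-odd F 𝒫 !𝒫 |𝒫|≡8q² =
  let e , q≤9k = many-rich-radii (odd⇒positive q-odd) |𝒫|≡8q²
  in richRadii e , richRadii-unique e , richRadii-determined e , q≤9k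
  where
  open Counting using (odd⇒positive)
  open Incidences F 𝒫
  open WithUniquePoints (Space.2≢0 F q-odd) !𝒫
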